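{- Let $C_k=\frac{1}{k+1}\binom{2k}{k}$ denote the $k$-th Catalan number, and let $m\geq 2$. (a) If $n\geq 4$ is even, $u\in D_{n-2}$, and $L_{m\times n}$ is the set of binary $m\times n$ matrices with rows $A_1,\dots,A_m$ such that $A_1=1u0$, $A_i\neq 1u0$ for $i\geq 2$, each $A_i$ ($2\leq i\leq m-1$) is of one of the forms $A_i\in D_n$, $A_i=11w$, $A_i=w00$, $A_i=01w$ (with $w\in D_{n-2}$, $w\neq u$ in these three forms), or $A_i=0w0$ ($w\in D_{n-2}$), and $A_m$ is of one of the forms $A_m\in D_n$, $A_m=11w$, $A_m=w00$ ($w\in D_{n-2}$, $w\neq u$), then $$|L_{m\times n}|=\left(C_{n/2}-1+4C_{(n-2)/2}-3\right)^{m-2}\left(C_{n/2}-1+2C_{(n-2)/2}-2\right).$$ (b) If $n\geq 5$ is odd, $u\in D_{n-3}$, and $L_{m\times n}$ is the set of binary $m\times n$ matrices with rows $A_1,\dots,A_m$ such that $A_1=11u0$, $A_i\neq 11u0$ for $i\geq 2$, each $A_i$ ($2\leq i\leq m-1$) is of one of the forms $A_i=1w$, $A_i=w0$ (with $w\in D_{n-1}$, $w\neq 1u0$) or $A_i=0w$ ($w\in D_{n-1}$), and $A_m$ is of one of the forms $A_m=1w$, $A_m=w0$ ($w\in D_{n-1}$, $w\neq 1u0$), then $$|L_{m\times n}|=\left(3C_{(n-1)/2}-2\right)^{m-2}\left(2C_{(n-1)/2}-2\right).$$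
   Context: For $\ell\geq 1$, a Dyck word of length $2\ell$ is a binary string $v$ of length $2\ell$ with equally many $1$'s and $0$'s such that every prefix of $v$ contains at least as many $1$'s as $0$'s; $D_{2\ell}$ denotes the set of Dyck words of length $2\ell$, and $|D_{2\ell}|=C_\ell$. Concatenation of strings is written by juxtaposition; rows of a binary $m\times n$ matrix are read as binary strings of length $n$. -}

module Defs where

open import Data.Bool using (Bool; true; false)
open import Data.Nat using (ℕ; zero; suc; _+_; _*_; _∸_; _≤_; _≡ᵇ_)
open import Data.Nat.DivMod using (_/_)
open import Data.Nat.Combinatorics using (_C_)
open import Data.List using (List; []; _∷_; _++_; length; take)
open import Data.List.Membership.Propositional using (_∈_)
open import Data.List.Relation.Unary.Unique.Propositional using (Unique)
open import Data.Vec using (Vec; lookup; toList)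
open import Data.Fin using (Fin; toℕ)
open import Data.Product using (Σ; ∃; _×_; _,_)
open import Data.Sum using (_⊎_)
open import Function.Bundles using (_⇔_)
open import Relation.Binary.PropositionalEquality using (_≡_; _≢_)

Catalan : ℕ → ℕ
Catalan k = ((2 * k) C k) / suc k

ones : List Bool → ℕ
ones [] = 0
ones (true ∷ v) = suc (ones v)
ones (false ∷ v) = ones v

zeros : List Bool → ℕ
zeros [] = 0
zeros (true ∷ v) = zeros v
zeros (false ∷ v) = suc (zeros v)

IsDyck : List Bool → Set
IsDyck v = (ones v ≡ zeros v) × (∀ k → zeros (take k v) ≤ ones (take k v))

InD : ℕ → List Bool → Set
InD len v = (length v ≡ len) × IsDyck v

Matrix : ℕ → ℕ → Set
Matrix m n = Vec (Vec Bool n) m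

row : ∀ {m n} → Matrix m n → Fin m → List Bool
row A i = toList (lookup A i)

HasCard : ∀ {m n} → (Matrix m n → Set) → ℕ → Set
HasCard {m} {n} S N =
  Σ (List (Matrix m n)) λ xs → Unique xs × (∀ A → (A ∈ xs) ⇔ S A) × (length xs ≡ N)

module PartA (n : ℕ) (u : List Bool) where
  first : List Bool
  first = true ∷ u ++ false ∷ []

  FormD : List Bool → Set
  FormD r = InD n r
  Form11 : List Bool → Set
  Form11 r = ∃ λ w → InD (n ∸ 2) w × w ≢ u × r ≡ true ∷ true ∷ w
  Form00 : List Bool → Set
  Form00 r = ∃ λ w → InD (n ∸ 2) w × w ≢ u × r ≡ w ++ false ∷ false ∷ []
  Form01 : List Bool → Set
  Form01 r = ∃ λ w → InD (n ∸ 2) w × w ≢ u × r ≡ false ∷ true ∷ w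
  Form0w0 : List Bool → Set
  Form0w0 r = ∃ λ w → InD (n ∸ 2) w × r ≡ false ∷ w ++ false ∷ []

  MiddleRow : List Bool → Set
  MiddleRow r = FormD r ⊎ Form11 r ⊎ Form00 r ⊎ Form01 r ⊎ Form0w0 r

  LastRow : List Bool → Set
  LastRow r = FormD r ⊎ Form11 r ⊎ Form00 r

  InL : ∀ {m} → Matrix m n → Set
  InL {m} A =
    (∀ (i : Fin m) → toℕ i ≡ 0 → row A i ≡ first) ×
    (∀ (i : Fin m) → 1 ≤ toℕ i → row A i ≢ first) ×
    (∀ (i : Fin m) → 1 ≤ toℕ i → suc (toℕ i) ≤ m ∸ 1 → MiddleRow (row A i)) ×
    (∀ (i : Fin m) → suc (toℕ i) ≡ m → LastRow (row A i))

module PartB (n : ℕ) (u : List Bool) where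
  first : List Bool
  first = true ∷ true ∷ u ++ false ∷ []

  forbidden : List Bool
  forbidden = true ∷ u ++ false ∷ []

  Form1w : List Bool → Set
  Form1w r = ∃ λ w → InD (n ∸ 1) w × w ≢ forbidden × r ≡ true ∷ w
  Formw0 : List Bool → Set
  Formw0 r = ∃ λ w → InD (n ∸ 1) w × w ≢ forbidden × r ≡ w ++ false ∷ []
  Form0w : List Bool → Set
  Form0w r = ∃ λ w → InD (n ∸ 1) w × r ≡ false ∷ w

  MiddleRow : List Bool → Set
  MiddleRow r = Form1w r ⊎ Formw0 r ⊎ Form0w r

  LastRow : List Bool → Set
  LastRow r = Form1w r ⊎ Formw0 r

  InL : ∀ {m} → Matrix m n → Set
  InL {m} A =
    (∀ (i : Fin m) → toℕ i ≡ 0 → row A i ≡ first) ×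
    (∀ (i : Fin m) → 1 ≤ toℕ i → row A i ≢ first) ×
    (∀ (i : Fin m) → 1 ≤ toℕ i → suc (toℕ i) ≤ m ∸ 1 → MiddleRow (row A i)) ×
    (∀ (i : Fin m) → suc (toℕ i) ≡ m → LastRow (row A i))

module Submission where

-- A matrix of L_{m×n} is a fixed first row followed by m−2 "middle" rows and
-- one "last" row, each chosen independently from a finite set of admissible
-- rows different from the first row.  Hence |L_{m×n}| = M^{m−2}·T, where M and
-- T count the admissible middle and last rows.  Each admissible set is a
-- disjoint union of row shapes (11w, w00, 0w0, ...) built from Dyck words w,
-- so M and T are sums of Catalan numbers, possibly minus 1 for an excluded word.

open import Defs
open import Data.Bool using (Bool; true; false) renaming (_≟_ to _≟ᵇ_)
open import Data.Empty using (⊥; ⊥-elim)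
open import Data.Fin using (Fin; toℕ; zero; suc)
open import Data.List
  using (List; []; _∷_; _++_; length; map; take; replicate; filter; cartesianProductWith)
open import Data.List.Properties
  using (length-++; length-map; length-replicate; filter-all; ∷-injectiveʳ; ++-cancelʳ; ≡-dec)
open import Data.List.Membership.Propositional using (_∈_)
open import Data.List.Membership.Propositional.Properties
  using (∈-map⁺; ∈-map⁻; ∈-++⁺ˡ; ∈-++⁺ʳ; ∈-++⁻; ∈-filter⁺; ∈-filter⁻;
         ∈-cartesianProductWith⁺; ∈-cartesianProductWith⁻)
open import Data.List.Relation.Unary.Any using (here; there)
open import Data.List.Relation.Unary.All as All using ([]; _∷_)
open import Data.List.Relation.Unary.AllPairs using ([]; _∷_)
open import Data.List.Relation.Unary.Unique.Propositional using (Unique)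
open import Data.List.Relation.Unary.Unique.Propositional.Properties
  using (map⁺; map⁻; ++⁺; filter⁺; cartesianProductWith⁺)
open import Data.Nat
  using (ℕ; zero; suc; _+_; _*_; _∸_; _^_; _≤_; _<_; z≤n; s≤s; s≤s⁻¹; _≤?_; ⌊_/2⌋)
open import Data.Nat.Combinatorics using (_C_; nCk+nC[k+1]≡[n+1]C[k+1]; nCk≡nC[n∸k]; nC1≡n)
open import Data.Nat.DivMod using (_/_; _%_; m≡m%n+[m/n]*n; m*n/n≡m)
open import Data.Nat.Properties
open import Algebra.Properties.CommutativeSemigroup +-commutativeSemigroup
  using () renaming (interchange to +-interchange)
open import Data.Nat.Tactic.RingSolver using (solve-∀)
open import Data.Product using (Σ; ∃; ∃₂; _×_; _,_; proj₁; proj₂)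
open import Data.Sum using (_⊎_; inj₁; inj₂; [_,_])
open import Data.Vec using (Vec; []; _∷_; lookup; toList)
open import Data.Vec.Properties using (∷-injective)
open import Function using (_∘_)
open import Function.Bundles using (_⇔_; mk⇔; Equivalence)
open import Function.Construct.Composition using (_⇔-∘_)
open import Function.Definitions using (Injective)
open import Relation.Binary.Definitions using (DecidableEquality)
open import Relation.Binary.PropositionalEquality hiding ([_])
open import Relation.Nullary using (¬_; Dec; yes; no; ¬?)

open Equivalence using (to; from)

-- (1) Finite counting

Counted : {A : Set} → (A → Set) → ℕ → Set
Counted {A} P N =
  Σ (List A) λ xs → Unique xs × (∀ x → (x ∈ xs) ⇔ P x) × (length xs ≡ N)

module _ {A : Set} where

  counted-⇔ : ∀ {P Q : A → Set} {N M} →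
              (∀ x → P x ⇔ Q x) → N ≡ M → Counted P N → Counted Q M
  counted-⇔ P⇔Q refl (xs , uniq , mem , len) =
    xs , uniq , (λ x → P⇔Q x ⇔-∘ mem x) , len

  counted-singleton : (a : A) → Counted (_≡ a) 1
  counted-singleton a =
    a ∷ [] , [] ∷ [] , (λ x → mk⇔ (λ { (here e) → e ; (there ()) }) here) , refl

  counted-positive : ∀ {P : A → Set} {N x} → Counted P N → P x → 1 ≤ N
  counted-positive {x = x} (_ , _ , mem , refl) p with from (mem x) p
  ... | here _  = s≤s z≤n
  ... | there _ = s≤s z≤n

  counted-⊎ : ∀ {P Q : A → Set} {N M} → Counted P N → Counted Q M →
              (∀ x → P x → ¬ Q x) → Counted (λ x → P x ⊎ Q x) (N + M)
  counted-⊎ (xs , uxs , mxs , lxs) (ys , uys , mys , lys) disjoint =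
    xs ++ ys ,
    ++⁺ uxs uys (λ {x} (x∈xs , x∈ys) → disjoint x (to (mxs x) x∈xs) (to (mys x) x∈ys)) ,
    (λ x → mk⇔ (λ x∈ → [ inj₁ ∘ to (mxs x) , inj₂ ∘ to (mys x) ] (∈-++⁻ xs x∈))
               [ ∈-++⁺ˡ ∘ from (mxs x) , ∈-++⁺ʳ xs ∘ from (mys x) ]) ,
    trans (length-++ xs) (cong₂ _+_ lxs lys)

  module _ (_≟_ : DecidableEquality A) (a : A) where

    without : List A → List A
    without = filter (λ x → ¬? (x ≟ a))

    length-without : ∀ {xs} → Unique xs → a ∈ xs → suc (length (without xs)) ≡ length xs
    length-without {x ∷ xs} (x∉xs ∷ uxs) a∈ with x ≟ a | a∈
    ... | yes refl | _          =
      cong (suc ∘ length) (filter-all _ (All.map (λ a≢y a≡y → a≢y (sym a≡y)) x∉xs))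
    ... | no x≢a   | here a≡x   = ⊥-elim (x≢a (sym a≡x))
    ... | no x≢a   | there a∈xs = cong suc (length-without uxs a∈xs)

  counted-remove : ∀ {P : A → Set} {N} → DecidableEquality A → Counted P N →
                   (a : A) → P a → Counted (λ x → P x × x ≢ a) (N ∸ 1)
  counted-remove _≟_ (xs , uxs , mxs , refl) a pa =
    without _≟_ a xs ,
    filter⁺ _ uxs ,
    (λ x → mk⇔ (λ x∈ → let (x∈xs , x≢a) = ∈-filter⁻ _ x∈ in to (mxs x) x∈xs , x≢a)
               (λ (px , x≢a) → ∈-filter⁺ _ (from (mxs x) px) x≢a)) ,
    cong (_∸ 1) (length-without _≟_ a {xs} uxs (from (mxs a) pa))

  counted-avoid : ∀ {P : A → Set} {N} {a : A} → Counted P N → (∀ x → P x → x ≢ a) →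
                  Counted (λ x → P x × x ≢ a) N
  counted-avoid counted P⇒≢a =
    counted-⇔ (λ x → mk⇔ (λ px → px , P⇒≢a x px) proj₁) refl counted

  apart-⊎ : ∀ {P Q R : A → Set} → (∀ x → P x → ¬ Q x) → (∀ x → P x → ¬ R x) →
            ∀ x → P x → ¬ (Q x ⊎ R x)
  apart-⊎ P∩Q P∩R x px = [ P∩Q x px , P∩R x px ]

counted-image : ∀ {A B : Set} {P : A → Set} {N} (f : A → B) → Injective _≡_ _≡_ f →
                Counted P N → Counted (λ y → ∃ λ x → P x × y ≡ f x) N
counted-image f f-inj (xs , uxs , mxs , lxs) =
  map f xs , map⁺ f-inj uxs ,
  (λ y → mk⇔ (λ y∈ → let (x , x∈xs , y≡fx) = ∈-map⁻ f y∈ in x , to (mxs x) x∈xs , y≡fx)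
             (λ { (x , px , refl) → ∈-map⁺ f (from (mxs x) px) })) ,
  trans (length-map f xs) lxs

counted-image-without : ∀ {A B : Set} {P : A → Set} {N} → DecidableEquality A →
                        (f : A → B) → Injective _≡_ _≡_ f → Counted P N → (a : A) → P a →
                        Counted (λ y → ∃ λ x → P x × x ≢ a × y ≡ f x) (N ∸ 1)
counted-image-without _≟_ f f-inj counted a pa =
  counted-⇔ (λ y → mk⇔ (λ (x , (px , x≢a) , y≡fx) → x , px , x≢a , y≡fx)
                       (λ (x , px , x≢a , y≡fx) → x , (px , x≢a) , y≡fx))
            refl (counted-image f f-inj (counted-remove _≟_ counted a pa))

length-cartesianProductWith : ∀ {A B C : Set} (f : A → B → C) xs ys →
  length (cartesianProductWith f xs ys) ≡ length xs * length ys
length-cartesianProductWith f []       ys = refl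
length-cartesianProductWith f (x ∷ xs) ys = begin
  length (map (f x) ys ++ cartesianProductWith f xs ys)
    ≡⟨ length-++ (map (f x) ys) ⟩
  length (map (f x) ys) + length (cartesianProductWith f xs ys)
    ≡⟨ cong₂ _+_ (length-map (f x) ys) (length-cartesianProductWith f xs ys) ⟩
  length ys + length xs * length ys ∎
  where open ≡-Reasoning

counted-product : ∀ {A B C : Set} {P : A → Set} {Q : B → Set} {N M} (f : A → B → C) →
                  (∀ {a a′ b b′} → f a b ≡ f a′ b′ → a ≡ a′ × b ≡ b′) →
                  Counted P N → Counted Q M →
                  Counted (λ c → ∃₂ λ a b → P a × Q b × c ≡ f a b) (N * M)
counted-product f f-inj (xs , uxs , mxs , lxs) (ys , uys , mys , lys) =
  cartesianProductWith f xs ys ,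
  cartesianProductWith⁺ f f-inj uxs uys ,
  (λ c → mk⇔ (λ c∈ → let (a , b , a∈ , b∈ , c≡fab) = ∈-cartesianProductWith⁻ f xs ys c∈
                     in a , b , to (mxs a) a∈ , to (mys b) b∈ , c≡fab)
             (λ { (a , b , pa , qb , refl) →
                    ∈-cartesianProductWith⁺ f (from (mxs a) pa) (from (mys b) qb) })) ,
  trans (length-cartesianProductWith f xs ys) (cong₂ _*_ lxs lys)

-- (2) Framed vectors

-- `Framed A` is the membership condition of L_{m×n} with the row conditions
-- abstracted: entry 0 satisfies F, every later entry NF, the entries strictly
-- between the first and the last Mi, and the last entry La.
module FramedVectors {R : Set} (F NF Mi La : R → Set) where

  Framed : ∀ {m} → Vec R m → Set
  Framed {m} A =
    (∀ (i : Fin m) → toℕ i ≡ 0 → F (lookup A i)) ×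
    (∀ (i : Fin m) → 1 ≤ toℕ i → NF (lookup A i)) ×
    (∀ (i : Fin m) → 1 ≤ toℕ i → suc (toℕ i) ≤ m ∸ 1 → Mi (lookup A i)) ×
    (∀ (i : Fin m) → suc (toℕ i) ≡ m → La (lookup A i))

  ValidTail : ∀ k → Vec R (suc k) → Set
  ValidTail zero    (r ∷ []) = La r × NF r
  ValidTail (suc k) (r ∷ rs) = (Mi r × NF r) × ValidTail k rs

  tail-NF : ∀ k rs → ValidTail k rs → ∀ j → NF (lookup rs j)
  tail-NF zero    (r ∷ []) (_ , nf)       zero    = nf
  tail-NF (suc k) (r ∷ rs) ((_ , nf) , _) zero    = nf
  tail-NF (suc k) (r ∷ rs) (_ , valid)    (suc j) = tail-NF k rs valid j

  tail-Mi : ∀ k rs → ValidTail k rs → ∀ j → suc (toℕ j) ≤ k → Mi (lookup rs j)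
  tail-Mi (suc k) (r ∷ rs) ((mi , _) , _) zero    _         = mi
  tail-Mi (suc k) (r ∷ rs) (_ , valid)    (suc j) (s≤s j<k) = tail-Mi k rs valid j j<k

  tail-La : ∀ k rs → ValidTail k rs → ∀ j → toℕ j ≡ k → La (lookup rs j)
  tail-La zero    (r ∷ []) (la , _)    zero    _   = la
  tail-La (suc k) (r ∷ rs) (_ , valid) (suc j) j≡k = tail-La k rs valid j (suc-injective j≡k)

  valid-tail : ∀ k rs → (∀ j → NF (lookup rs j)) →
               (∀ j → suc (toℕ j) ≤ k → Mi (lookup rs j)) →
               (∀ j → toℕ j ≡ k → La (lookup rs j)) → ValidTail k rs
  valid-tail zero    (r ∷ []) nf mi la = la zero refl , nf zero
  valid-tail (suc k) (r ∷ rs) nf mi la =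
    (mi zero (s≤s z≤n) , nf zero) ,
    valid-tail k rs (nf ∘ suc) (λ j j<k → mi (suc j) (s≤s j<k))
                               (λ j j≡k → la (suc j) (cong suc j≡k))

  framed⇔ : ∀ k r (rs : Vec R (suc k)) → (F r × ValidTail k rs) ⇔ Framed (r ∷ rs)
  framed⇔ k r rs = mk⇔ framed unframed
    where
    framed : F r × ValidTail k rs → Framed (r ∷ rs)
    framed (f , valid) = first , later , middle , last
      where
      first : ∀ i → toℕ i ≡ 0 → F (lookup (r ∷ rs) i)
      first zero _ = f
      later : ∀ i → 1 ≤ toℕ i → NF (lookup (r ∷ rs) i)
      later (suc j) _ = tail-NF k rs valid j
      middle : ∀ i → 1 ≤ toℕ i → suc (toℕ i) ≤ suc k → Mi (lookup (r ∷ rs) i)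
      middle (suc j) _ (s≤s j<k) = tail-Mi k rs valid j j<k
      last : ∀ i → suc (toℕ i) ≡ suc (suc k) → La (lookup (r ∷ rs) i)
      last zero    ()
      last (suc j) j≡k = tail-La k rs valid j (suc-injective (suc-injective j≡k))
    unframed : Framed (r ∷ rs) → F r × ValidTail k rs
    unframed (first , later , middle , last) =
      first zero refl ,
      valid-tail k rs (λ j → later (suc j) (s≤s z≤n))
                      (λ j j<k → middle (suc j) (s≤s z≤n) (s≤s j<k))
                      (λ j j≡k → last (suc j) (cong (λ i → suc (suc i)) j≡k))

  module _ {a b : ℕ} (middleEntries : Counted (λ r → Mi r × NF r) a)
                     (lastEntries   : Counted (λ r → La r × NF r) b) where

    counted-ValidTail : ∀ k → Counted (ValidTail k) (a ^ k * b)
    counted-ValidTail zero =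
      counted-⇔ (λ { (r ∷ []) → mk⇔ (λ { (_ , valid , refl) → valid })
                                     (λ valid → r , valid , refl) })
                (sym (*-identityˡ b))
                (counted-image (_∷ []) (proj₁ ∘ ∷-injective) lastEntries)
    counted-ValidTail (suc k) =
      counted-⇔ (λ { (r ∷ rs) → mk⇔ (λ { (_ , _ , mi , valid , refl) → mi , valid })
                                    (λ (mi , valid) → r , rs , mi , valid , refl) })
                (sym (*-assoc a (a ^ k) b))
                (counted-product _∷_ ∷-injective middleEntries (counted-ValidTail k))

    counted-Framed : Counted F 1 → ∀ k → Counted (Framed {suc (suc k)}) (a ^ k * b)
    counted-Framed firstEntries k =
      counted-⇔ (λ { (r ∷ rs) →
                       mk⇔ (λ { (_ , _ , f , valid , refl) → to (framed⇔ k r rs) (f , valid) })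
                           (λ framed → let (f , valid) = from (framed⇔ k r rs) framed
                                       in r , rs , f , valid , refl) })
                (*-identityˡ (a ^ k * b))
                (counted-product _∷_ ∷-injective firstEntries (counted-ValidTail k))

-- (3) Rows as vectors

fit : (n : ℕ) → List Bool → Vec Bool n
fit zero    _        = []
fit (suc n) []       = false ∷ fit n []
fit (suc n) (x ∷ xs) = x ∷ fit n xs

toList-fit : ∀ n xs → length xs ≡ n → toList (fit n xs) ≡ xs
toList-fit zero    []       _   = refl
toList-fit (suc n) (x ∷ xs) len = cong (x ∷_) (toList-fit n xs (suc-injective len))

fit-toList : ∀ {n} (v : Vec Bool n) → fit n (toList v) ≡ v
fit-toList []      = refl
fit-toList (x ∷ v) = cong (x ∷_) (fit-toList v)

counted-rows : ∀ {n N} {P : List Bool → Set} → (∀ r → P r → length r ≡ n) →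
               Counted P N → Counted (λ (v : Vec Bool n) → P (toList v)) N
counted-rows {n} {P = P} P⇒length (xs , uxs , mxs , lxs) =
  map (fit n) xs ,
  map⁻ (subst Unique (sym (toList-fit-all xs (λ r r∈ → P⇒length r (to (mxs r) r∈)))) uxs) ,
  (λ v → mk⇔ (λ v∈ → let (r , r∈ , v≡fit) = ∈-map⁻ (fit n) v∈
                         pr = to (mxs r) r∈
                         v↦r = trans (cong toList v≡fit) (toList-fit n r (P⇒length r pr))
                     in subst P (sym v↦r) pr)
             (λ pv → subst (_∈ map (fit n) xs) (fit-toList v)
                           (∈-map⁺ (fit n) (from (mxs (toList v)) pv)))) ,
  trans (length-map (fit n) xs) lxs
  where
  toList-fit-all : ∀ ys → (∀ y → y ∈ ys → length y ≡ n) → map toList (map (fit n) ys) ≡ ys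
  toList-fit-all []       _   = refl
  toList-fit-all (y ∷ ys) len = cong₂ _∷_ (toList-fit n y (len y (here refl)))
                                          (toList-fit-all ys (λ z z∈ → len z (there z∈)))

-- (4) Dyck words are counted by the Catalan numbers

ones-++ : ∀ u v → ones (u ++ v) ≡ ones u + ones v
ones-++ []          v = refl
ones-++ (true ∷ u)  v = cong suc (ones-++ u v)
ones-++ (false ∷ u) v = ones-++ u v

zeros-++ : ∀ u v → zeros (u ++ v) ≡ zeros u + zeros v
zeros-++ []          v = refl
zeros-++ (true ∷ u)  v = zeros-++ u v
zeros-++ (false ∷ u) v = cong suc (zeros-++ u v)

ones-replicate : ∀ z → ones (replicate z false) ≡ 0
ones-replicate zero    = refl
ones-replicate (suc z) = ones-replicate z

zeros-replicate : ∀ z → zeros (replicate z false) ≡ z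
zeros-replicate zero    = refl
zeros-replicate (suc z) = cong suc (zeros-replicate z)

ones-zeros-suffix : ∀ w z → ones (w ++ replicate z false) ≡ ones w
ones-zeros-suffix w z =
  trans (ones-++ w (replicate z false))
        (trans (cong (ones w +_) (ones-replicate z)) (+-identityʳ (ones w)))

length-zeros-suffix : ∀ w z → length (w ++ replicate z false) ≡ z + length w
length-zeros-suffix w z =
  trans (length-++ w) (trans (cong (length w +_) (length-replicate z)) (+-comm (length w) z))

length≡ones+zeros : ∀ v → length v ≡ ones v + zeros v
length≡ones+zeros []          = refl
length≡ones+zeros (true ∷ v)  = cong suc (length≡ones+zeros v)
length≡ones+zeros (false ∷ v) =
  trans (cong suc (length≡ones+zeros v)) (sym (+-suc (ones v) (zeros v)))

zeros-take≤zeros : ∀ k v → zeros (take k v) ≤ zeros v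
zeros-take≤zeros zero    v           = z≤n
zeros-take≤zeros (suc k) []          = z≤n
zeros-take≤zeros (suc k) (true ∷ v)  = zeros-take≤zeros k v
zeros-take≤zeros (suc k) (false ∷ v) = s≤s (zeros-take≤zeros k v)

-- `Completion a b s`: s has a ones and b zeros and can follow a Dyck prefix of
-- excess b − a, i.e. the running excess (b − a) + #1 − #0 along s never becomes
-- negative.  Dyck words of length 2k are the completions with a = b = k.
Completion : ℕ → ℕ → List Bool → Set
Completion a b s =
  ones s ≡ a × zeros s ≡ b × (∀ k → a + zeros (take k s) ≤ b + ones (take k s))

completion-true : ∀ {a b s} → a ≤ b → Completion a (suc b) s →
                  Completion (suc a) (suc b) (true ∷ s)
completion-true {a} {b} {s} a≤b (o , z , pre) = cong suc o , z , pre′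
  where
  pre′ : ∀ k → suc a + zeros (take k (true ∷ s)) ≤ suc b + ones (take k (true ∷ s))
  pre′ zero    = s≤s (+-monoˡ-≤ 0 a≤b)
  pre′ (suc k) = s≤s (≤-trans (pre k) (≤-reflexive (sym (+-suc b (ones (take k s))))))

completion-true⁻ : ∀ {a b s} → Completion (suc a) (suc b) (true ∷ s) →
                   a ≤ b × Completion a (suc b) s
completion-true⁻ {a} {b} {s} (o , z , pre) =
  +-cancelʳ-≤ 0 a b (s≤s⁻¹ (pre 0)) , suc-injective o , z ,
  λ k → ≤-trans (s≤s⁻¹ (pre (suc k))) (≤-reflexive (+-suc b (ones (take k s))))

completion-false : ∀ {a b s} → suc a ≤ b → Completion (suc a) b s →
                   Completion (suc a) (suc b) (false ∷ s)
completion-false {a} {b} {s} a<b (o , z , pre) = o , cong suc z , pre′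
  where
  pre′ : ∀ k → suc a + zeros (take k (false ∷ s)) ≤ suc b + ones (take k (false ∷ s))
  pre′ zero    = s≤s (+-monoˡ-≤ 0 (<⇒≤ a<b))
  pre′ (suc k) = ≤-trans (≤-reflexive (+-suc (suc a) (zeros (take k s)))) (s≤s (pre k))

completion-false⁻ : ∀ {a b s} → Completion (suc a) (suc b) (false ∷ s) →
                    suc a ≤ b × Completion (suc a) b s
completion-false⁻ {a} {b} {s} (o , z , pre) =
  s≤s⁻¹ (subst₂ _≤_ (+-comm (suc a) 1) (+-identityʳ (suc b)) (pre 1)) , o , suc-injective z ,
  λ k → s≤s⁻¹ (≤-trans (≤-reflexive (sym (+-suc (suc a) (zeros (take k s))))) (pre (suc k)))

completion-zero : ∀ {b s} → Completion 0 b s ⇔ s ≡ replicate b false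
completion-zero {b} {s} =
  mk⇔ (λ (o , z , _) → trans (no-ones s o) (cong (λ c → replicate c false) z))
      (λ { refl → ones-replicate b , zeros-replicate b ,
                  λ k → ≤-trans (zeros-take≤zeros k (replicate b false))
                                (≤-trans (≤-reflexive (zeros-replicate b)) (m≤m+n b _)) })
  where
  no-ones : ∀ s → ones s ≡ 0 → s ≡ replicate (zeros s) false
  no-ones []          _ = refl
  no-ones (false ∷ s) o = cong (false ∷_) (no-ones s o)

when : {P X : Set} → Dec P → List X → List X
when (yes _) xs = xs
when (no _)  _  = []

∈-when : ∀ {P X : Set} (d : Dec P) {xs : List X} {x} → x ∈ when d xs ⇔ (P × x ∈ xs)
∈-when (yes p) = mk⇔ (p ,_) proj₂
∈-when (no ¬p) = mk⇔ (λ ()) (λ (p , _) → ⊥-elim (¬p p))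

when-unique : ∀ {P X : Set} (d : Dec P) {xs : List X} → Unique xs → Unique (when d xs)
when-unique (yes _) uxs = uxs
when-unique (no _)  _   = []

prefixAll : Bool → List (List Bool) → List (List Bool)
prefixAll c = map (c ∷_)

length-prefixAll : ∀ c xs → length (prefixAll c xs) ≡ length xs
length-prefixAll c = length-map (c ∷_)

completions : ℕ → ℕ → List (List Bool)
completions zero    b       = replicate b false ∷ []
completions (suc a) zero    = []
completions (suc a) (suc b) =
  when (a ≤? b) (prefixAll true (completions a (suc b))) ++
  when (suc a ≤? b) (prefixAll false (completions (suc a) b))

completions-sound : ∀ a b {s} → s ∈ completions a b → Completion a b s
completions-sound zero    b       (here s≡zeros) = from completion-zero s≡zeros
completions-sound (suc a) (suc b) s∈
  with ∈-++⁻ (when (a ≤? b) (prefixAll true (completions a (suc b)))) s∈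
... | inj₁ s∈₁ with to (∈-when (a ≤? b)) s∈₁
...   | a≤b , s∈′ with ∈-map⁻ (true ∷_) s∈′
...     | t , t∈ , refl = completion-true a≤b (completions-sound a (suc b) t∈)
completions-sound (suc a) (suc b) s∈ | inj₂ s∈₂ with to (∈-when (suc a ≤? b)) s∈₂
...   | a<b , s∈′ with ∈-map⁻ (false ∷_) s∈′
...     | t , t∈ , refl = completion-false a<b (completions-sound (suc a) b t∈)

completions-complete : ∀ a b s → Completion a b s → s ∈ completions a b
completions-complete zero    b       s c = here (to completion-zero c)
completions-complete (suc a) zero    s (_ , _ , pre) with pre 0
... | ()
completions-complete (suc a) (suc b) (true ∷ s) c =
  let (a≤b , c′) = completion-true⁻ c in
  ∈-++⁺ˡ (from (∈-when (a ≤? b)) (a≤b , ∈-map⁺ (true ∷_) (completions-complete a (suc b) s c′)))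
completions-complete (suc a) (suc b) (false ∷ s) c =
  let (a<b , c′) = completion-false⁻ c in
  ∈-++⁺ʳ (when (a ≤? b) (prefixAll true (completions a (suc b))))
         (from (∈-when (suc a ≤? b))
               (a<b , ∈-map⁺ (false ∷_) (completions-complete (suc a) b s c′)))

completions-unique : ∀ a b → Unique (completions a b)
completions-unique zero    b       = [] ∷ []
completions-unique (suc a) zero    = []
completions-unique (suc a) (suc b) =
  ++⁺ (when-unique (a ≤? b) (map⁺ ∷-injectiveʳ (completions-unique a (suc b))))
      (when-unique (suc a ≤? b) (map⁺ ∷-injectiveʳ (completions-unique (suc a) b)))
      (λ (s∈₁ , s∈₂) → different-heads (proj₂ (to (∈-when (a ≤? b)) s∈₁))
                                       (proj₂ (to (∈-when (suc a ≤? b)) s∈₂)))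
  where
  different-heads : ∀ {s} {xs ys : List (List Bool)} →
                    s ∈ prefixAll true xs → s ∈ prefixAll false ys → ⊥
  different-heads s∈₁ s∈₂ with ∈-map⁻ (true ∷_) s∈₁ | ∈-map⁻ (false ∷_) s∈₂
  ... | _ , _ , refl | _ , _ , ()

counted-completions : ∀ a b → Counted (Completion a b) (length (completions a b))
counted-completions a b =
  completions a b , completions-unique a b ,
  (λ s → mk⇔ (completions-sound a b) (completions-complete a b s)) , refl

-- The recurrence for the number of completions: below the diagonal both first
-- letters are possible, on it only a one.
count-step : ∀ {a b} → a < b →
  length (completions (suc a) (suc b))
    ≡ length (completions a (suc b)) + length (completions (suc a) b)
count-step {a} {b} a<b with a ≤? b | suc a ≤? b
... | no a≰b | _      = ⊥-elim (a≰b (<⇒≤ a<b))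
... | yes _  | no a≮b = ⊥-elim (a≮b a<b)
... | yes _  | yes _  =
  trans (length-++ (prefixAll true (completions a (suc b))))
        (cong₂ _+_ (length-prefixAll true (completions a (suc b)))
                   (length-prefixAll false (completions (suc a) b)))

count-diagonal : ∀ a → length (completions (suc a) (suc a)) ≡ length (completions a (suc a))
count-diagonal a with a ≤? a | suc a ≤? a
... | no a≰a | _       = ⊥-elim (a≰a ≤-refl)
... | yes _  | yes a<a = ⊥-elim (n≮n a a<a)
... | yes _  | no _    =
  trans (length-++ (prefixAll true (completions a (suc a))))
        (trans (+-identityʳ _) (length-prefixAll true (completions a (suc a))))

-- binomPred n a = C(n, a − 1), with C(n, −1) = 0.
binomPred : ℕ → ℕ → ℕ
binomPred n zero    = 0
binomPred n (suc a) = n C a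

pascal-pred : ∀ n a → suc n C a ≡ binomPred n a + n C a
pascal-pred n zero    = refl
pascal-pred n (suc a) = sym (nCk+nC[k+1]≡[n+1]C[k+1] n a)

ballot : ∀ a b → a ≤ b → length (completions a b) + binomPred (a + b) a ≡ (a + b) C a
ballot zero    b       _         = refl
ballot (suc a) (suc b) (s≤s a≤b) with m≤n⇒m<n∨m≡n a≤b
... | inj₁ a<b = begin
  L + suc n C a                        ≡⟨ cong₂ _+_ (count-step a<b) (pascal-pred n a) ⟩
  (L₁ + L₂) + (binomPred n a + n C a)  ≡⟨ +-interchange L₁ L₂ (binomPred n a) (n C a) ⟩
  (L₁ + binomPred n a) + (L₂ + n C a)  ≡⟨ cong₂ _+_ (ballot a (suc b) (m≤n⇒m≤1+n a≤b)) ballot₂ ⟩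
  n C a + n C suc a                    ≡⟨ nCk+nC[k+1]≡[n+1]C[k+1] n a ⟩
  suc n C suc a                        ∎
  where
  open ≡-Reasoning
  n  = a + suc b
  L  = length (completions (suc a) (suc b))
  L₁ = length (completions a (suc b))
  L₂ = length (completions (suc a) b)
  ballot₂ : L₂ + n C a ≡ n C suc a
  ballot₂ = subst (λ m → L₂ + m C a ≡ m C suc a) (sym (+-suc a b)) (ballot (suc a) b a<b)
... | inj₂ refl = begin
  L + suc n C a                        ≡⟨ cong₂ _+_ (count-diagonal a) (pascal-pred n a) ⟩
  L₁ + (binomPred n a + n C a)         ≡⟨ sym (+-assoc L₁ (binomPred n a) (n C a)) ⟩
  (L₁ + binomPred n a) + n C a         ≡⟨ cong₂ _+_ (ballot a (suc a) (n≤1+n a)) middle-symmetry ⟩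
  n C a + n C suc a                    ≡⟨ nCk+nC[k+1]≡[n+1]C[k+1] n a ⟩
  suc n C suc a                        ∎
  where
  open ≡-Reasoning
  n  = a + suc a
  L  = length (completions (suc a) (suc a))
  L₁ = length (completions a (suc a))
  middle-symmetry : n C a ≡ n C suc a
  middle-symmetry = trans (nCk≡nC[n∸k] (m≤m+n a (suc a))) (cong (n C_) (m+n∸m≡n a (suc a)))

absorption : ∀ n k → suc k * (suc n C suc k) ≡ suc n * (n C k)
absorption n       zero    =
  trans (*-identityˡ _) (trans (nC1≡n (suc n)) (sym (*-identityʳ (suc n))))
absorption zero    (suc k) = *-zeroʳ (suc (suc k))
absorption (suc n) (suc k) = begin
  suc (suc k) * (suc (suc n) C suc (suc k))
    ≡⟨ cong (suc (suc k) *_) (sym (nCk+nC[k+1]≡[n+1]C[k+1] (suc n) (suc k))) ⟩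
  suc (suc k) * (X + Y)
    ≡⟨ *-distribˡ-+ (suc (suc k)) X Y ⟩
  (X + suc k * X) + suc (suc k) * Y
    ≡⟨ cong₂ (λ p q → (X + p) + q) (absorption n k) (absorption n (suc k)) ⟩
  (X + suc n * (n C k)) + suc n * (n C suc k)
    ≡⟨ +-assoc X _ _ ⟩
  X + (suc n * (n C k) + suc n * (n C suc k))
    ≡⟨ cong (X +_) (sym (*-distribˡ-+ (suc n) (n C k) (n C suc k))) ⟩
  X + suc n * (n C k + n C suc k)
    ≡⟨ cong (λ z → X + suc n * z) (nCk+nC[k+1]≡[n+1]C[k+1] n k) ⟩
  suc (suc n) * X ∎
  where
  open ≡-Reasoning
  X = suc n C suc k
  Y = suc n C suc (suc k)

near-middle : ∀ j → suc (suc j) * ((suc j + suc j) C j) ≡ suc j * ((suc j + suc j) C suc j)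
near-middle j = begin
  suc (suc j) * (N C j)
    ≡⟨ cong (suc (suc j) *_) (trans (nCk≡nC[n∸k] j≤N) (cong (N C_) N∸j)) ⟩
  suc (suc j) * (suc M C suc (suc j))
    ≡⟨ absorption M (suc j) ⟩
  suc M * (M C suc j)
    ≡⟨ cong (suc M *_) (trans (nCk≡nC[n∸k] (m≤n+m (suc j) j)) (cong (M C_) M∸sj)) ⟩
  suc M * (M C j)
    ≡⟨ sym (absorption M j) ⟩
  suc j * (N C suc j) ∎
  where
  open ≡-Reasoning
  N = suc j + suc j
  M = j + suc j
  j≤N : j ≤ N
  j≤N = ≤-trans (n≤1+n j) (m≤m+n (suc j) (suc j))
  N∸j : N ∸ j ≡ suc (suc j)
  N∸j = trans (cong (_∸ j) (sym (+-suc j (suc j)))) (m+n∸m≡n j (suc (suc j)))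
  M∸sj : M ∸ suc j ≡ j
  M∸sj = trans (cong (_∸ suc j) (+-comm j (suc j))) (m+n∸m≡n (suc j) j)

catalan-count : ∀ k → suc k * length (completions k k) ≡ (k + k) C k
catalan-count zero    = refl
catalan-count (suc j) = +-cancelʳ-≡ (suc j * X) _ _ (begin
  suc (suc j) * L + suc j * X              ≡⟨ cong (suc (suc j) * L +_) (sym (near-middle j)) ⟩
  suc (suc j) * L + suc (suc j) * (N C j)  ≡⟨ sym (*-distribˡ-+ (suc (suc j)) L (N C j)) ⟩
  suc (suc j) * (L + N C j)                ≡⟨ cong (suc (suc j) *_) (ballot (suc j) (suc j) ≤-refl) ⟩
  X + suc j * X                            ∎)
  where
  open ≡-Reasoning
  N = suc j + suc j
  X = N C suc j
  L = length (completions (suc j) (suc j))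

Catalan≡completions : ∀ k → Catalan k ≡ length (completions k k)
Catalan≡completions k = begin
  ((2 * k) C k) / suc k  ≡⟨ cong (λ m → ((k + m) C k) / suc k) (+-identityʳ k) ⟩
  ((k + k) C k) / suc k  ≡⟨ cong (_/ suc k) (sym (catalan-count k)) ⟩
  (suc k * L) / suc k    ≡⟨ cong (_/ suc k) (*-comm (suc k) L) ⟩
  (L * suc k) / suc k    ≡⟨ m*n/n≡m L (suc k) ⟩
  L                      ∎
  where
  open ≡-Reasoning
  L = length (completions k k)

dyck-ones : ∀ {L k v} → InD L v → L ≡ k + k → ones v ≡ k
dyck-ones {L} {k} {v} (len , balanced , _) L≡2k = begin
  ones v                  ≡⟨ n≡⌊n+n/2⌋ (ones v) ⟩
  ⌊ ones v + ones v /2⌋   ≡⟨ cong (λ z → ⌊ ones v + z /2⌋) balanced ⟩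
  ⌊ ones v + zeros v /2⌋  ≡⟨ cong ⌊_/2⌋ (trans (sym (length≡ones+zeros v)) (trans len L≡2k)) ⟩
  ⌊ k + k /2⌋             ≡⟨ sym (n≡⌊n+n/2⌋ k) ⟩
  k                       ∎
  where open ≡-Reasoning

completion⇔dyck : ∀ {L k} → L ≡ k + k → ∀ v → Completion k k v ⇔ InD L v
completion⇔dyck {L} {k} L≡2k v = mk⇔ from-completion to-completion
  where
  to-completion : InD L v → Completion k k v
  to-completion d@(_ , balanced , prefixes) =
    dyck-ones d L≡2k , trans (sym balanced) (dyck-ones d L≡2k) , λ j → +-monoʳ-≤ k (prefixes j)
  from-completion : Completion k k v → InD L v
  from-completion (o , z , prefixes) =
    trans (length≡ones+zeros v) (trans (cong₂ _+_ o z) (sym L≡2k)) ,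
    trans o (sym z) , λ j → +-cancelˡ-≤ k _ _ (prefixes j)

counted-Dyck : ∀ {L} k → L ≡ k + k → Counted (InD L) (Catalan k)
counted-Dyck k L≡2k =
  counted-⇔ (completion⇔dyck L≡2k) (sym (Catalan≡completions k)) (counted-completions k k)

dyck-head : ∀ {t} → ¬ IsDyck (false ∷ t)
dyck-head (_ , prefixes) with prefixes 1
... | ()

zeros-take-++ : ∀ j u v → zeros (take j (u ++ v)) ≤ zeros (take j u) + zeros v
zeros-take-++ zero    u           v = z≤n
zeros-take-++ (suc j) []          v = zeros-take≤zeros (suc j) v
zeros-take-++ (suc j) (true ∷ u)  v = zeros-take-++ j u v
zeros-take-++ (suc j) (false ∷ u) v = s≤s (zeros-take-++ j u v)

ones-take-++ : ∀ j u v → ones (take j u) ≤ ones (take j (u ++ v))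
ones-take-++ zero    u           v = z≤n
ones-take-++ (suc j) []          v = z≤n
ones-take-++ (suc j) (true ∷ u)  v = s≤s (ones-take-++ j u v)
ones-take-++ (suc j) (false ∷ u) v = ones-take-++ j u v

dyck-wrap : ∀ {L u} → InD L u → InD (suc (suc L)) (true ∷ u ++ false ∷ [])
dyck-wrap {L} {u} (len , balanced , prefixes) =
  cong suc (trans (length-zeros-suffix u 1) (cong suc len)) ,
  trans (cong suc (trans (ones-zeros-suffix u 1) balanced))
        (trans (+-comm 1 (zeros u)) (sym (zeros-++ u (false ∷ [])))) ,
  wrapped-prefixes
  where
  wrapped-prefixes : ∀ k → zeros (take k (true ∷ u ++ false ∷ []))
                           ≤ ones (take k (true ∷ u ++ false ∷ []))
  wrapped-prefixes zero    = z≤n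
  wrapped-prefixes (suc j) = begin
    zeros (take j (u ++ false ∷ []))      ≤⟨ zeros-take-++ j u (false ∷ []) ⟩
    zeros (take j u) + 1                  ≤⟨ +-monoˡ-≤ 1 (prefixes j) ⟩
    ones (take j u) + 1                   ≤⟨ +-monoˡ-≤ 1 (ones-take-++ j u (false ∷ [])) ⟩
    ones (take j (u ++ false ∷ [])) + 1   ≡⟨ +-comm _ 1 ⟩
    suc (ones (take j (u ++ false ∷ []))) ∎
    where open ≤-Reasoning

-- (5) Signatures

-- The signature of a word: its number of ones and whether it starts with a
-- zero.  Each row shape of the theorem has a constant signature, and shapes
-- with different signatures are disjoint.
startsWith0 : List Bool → Bool
startsWith0 (false ∷ _) = true
startsWith0 _           = false

signature : List Bool → ℕ × Bool
signature r = ones r , startsWith0 r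

Signed : (List Bool → Set) → ℕ × Bool → Set
Signed P s = ∀ {r} → P r → signature r ≡ s

apart : ∀ {P Q : List Bool → Set} {s t} → Signed P s → Signed Q t → s ≢ t →
        ∀ r → P r → ¬ Q r
apart P-signed Q-signed s≢t r p q = s≢t (trans (sym (P-signed p)) (Q-signed q))

signature-dyck : ∀ {L w k} → InD L w → ones w ≡ k → signature w ≡ (k , false)
signature-dyck {w = []}        _       refl = refl
signature-dyck {w = true ∷ _}  _       refl = refl
signature-dyck {w = false ∷ _} (_ , d) _    = ⊥-elim (dyck-head d)

signature-dyck-zeros : ∀ {L w k} z → InD (suc L) w → ones w ≡ k →
                       signature (w ++ replicate z false) ≡ (k , false)
signature-dyck-zeros {w = []}        z (() , _) _
signature-dyck-zeros {w = true ∷ w}  z _       refl = cong (λ o → suc o , false) (ones-zeros-suffix w z)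
signature-dyck-zeros {w = false ∷ _} z (_ , d) _    = ⊥-elim (dyck-head d)

-- (6) The row counts

_≟ʷ_ : DecidableEquality (List Bool)
_≟ʷ_ = ≡-dec _≟ᵇ_

∸-from-sum : ∀ {a b} c → a ≡ c + b → a ∸ c ≡ b
∸-from-sum {b = b} c refl = m+n∸m≡n c b

four-shapes : ∀ X → 1 ≤ X → (X ∸ 1) + ((X ∸ 1) + ((X ∸ 1) + X)) ≡ 4 * X ∸ 3
four-shapes (suc x) (s≤s _) = sym (∸-from-sum 3 (four x))
  where
  four : ∀ x → 4 * suc x ≡ 3 + (x + (x + (x + suc x)))
  four = solve-∀

three-shapes : ∀ X → 1 ≤ X → (X ∸ 1) + ((X ∸ 1) + X) ≡ 3 * X ∸ 2
three-shapes (suc x) (s≤s _) = sym (∸-from-sum 2 (three x))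
  where
  three : ∀ x → 3 * suc x ≡ 2 + (x + (x + suc x))
  three = solve-∀

two-shapes : ∀ X → 1 ≤ X → (X ∸ 1) + (X ∸ 1) ≡ 2 * X ∸ 2
two-shapes (suc x) (s≤s _) = sym (∸-from-sum 2 (two x))
  where
  two : ∀ x → 2 * suc x ≡ 2 + (x + x)
  two = solve-∀

-- Part (a), n = 2k + 2 with k = j + 1.  The five row shapes have signatures
--   D_n: (k+1, no),  11w: (k+2, no),  w00: (k, no),  01w: (k+1, yes),  0w0: (k, yes),
-- so they are pairwise disjoint; the first row 1u0 lies in D_n and is removed.
module RowsA (j : ℕ) (u : List Bool) (u∈D : InD (suc j + suc j) u) where
  k n : ℕ
  k = suc j
  n = suc (suc (k + k))
  open PartA n u

  n≡2k+2 : n ≡ suc k + suc k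
  n≡2k+2 = cong suc (sym (+-suc k k))

  first∈D : FormD first
  first∈D = dyck-wrap u∈D

  dyck-k : Counted (InD (k + k)) (Catalan k)
  dyck-k = counted-Dyck k refl

  countD : Counted FormD (Catalan (suc k))
  countD = counted-Dyck (suc k) n≡2k+2

  count11 : Counted Form11 (Catalan k ∸ 1)
  count11 = counted-image-without _≟ʷ_ (λ w → true ∷ true ∷ w) (λ { refl → refl }) dyck-k u u∈D

  count00 : Counted Form00 (Catalan k ∸ 1)
  count00 = counted-image-without _≟ʷ_ (_++ false ∷ false ∷ []) (++-cancelʳ _ _ _) dyck-k u u∈D

  count01 : Counted Form01 (Catalan k ∸ 1)
  count01 = counted-image-without _≟ʷ_ (λ w → false ∷ true ∷ w) (λ { refl → refl }) dyck-k u u∈D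

  count0w0 : Counted Form0w0 (Catalan k)
  count0w0 =
    counted-image (λ w → false ∷ w ++ false ∷ []) (++-cancelʳ _ _ _ ∘ ∷-injectiveʳ) dyck-k

  signedD : Signed FormD (suc k , false)
  signedD d = signature-dyck d (dyck-ones d n≡2k+2)

  signed11 : Signed Form11 (suc (suc k) , false)
  signed11 (w , d , _ , refl) = cong (λ o → suc (suc o) , false) (dyck-ones d refl)

  signed00 : Signed Form00 (k , false)
  signed00 (w , d , _ , refl) = signature-dyck-zeros 2 d (dyck-ones d refl)

  signed01 : Signed Form01 (suc k , true)
  signed01 (w , d , _ , refl) = cong (λ o → suc o , true) (dyck-ones d refl)

  signed0w0 : Signed Form0w0 (k , true)
  signed0w0 (w , d , refl) = cong (_, true) (trans (ones-zeros-suffix w 1) (dyck-ones d refl))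

  countMiddle : Counted MiddleRow
    (Catalan (suc k) + ((Catalan k ∸ 1) + ((Catalan k ∸ 1) + ((Catalan k ∸ 1) + Catalan k))))
  countMiddle =
    counted-⊎ countD
      (counted-⊎ count11 (counted-⊎ count00 (counted-⊎ count01 count0w0 01∩rest) 00∩rest) 11∩rest)
      D∩rest
    where
    01∩rest : ∀ r → Form01 r → ¬ Form0w0 r
    01∩rest = apart signed01 signed0w0 λ ()
    00∩rest : ∀ r → Form00 r → ¬ (Form01 r ⊎ Form0w0 r)
    00∩rest = apart-⊎ (apart signed00 signed01 λ ()) (apart signed00 signed0w0 λ ())
    11∩rest : ∀ r → Form11 r → ¬ (Form00 r ⊎ Form01 r ⊎ Form0w0 r)
    11∩rest = apart-⊎ (apart signed11 signed00 λ ())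
                      (apart-⊎ (apart signed11 signed01 λ ()) (apart signed11 signed0w0 λ ()))
    D∩rest : ∀ r → FormD r → ¬ (Form11 r ⊎ Form00 r ⊎ Form01 r ⊎ Form0w0 r)
    D∩rest = apart-⊎ (apart signedD signed11 λ ())
               (apart-⊎ (apart signedD signed00 λ ())
                 (apart-⊎ (apart signedD signed01 λ ()) (apart signedD signed0w0 λ ())))

  countLast : Counted LastRow (Catalan (suc k) + ((Catalan k ∸ 1) + (Catalan k ∸ 1)))
  countLast =
    counted-⊎ countD (counted-⊎ count11 count00 (apart signed11 signed00 λ ()))
      (apart-⊎ (apart signedD signed11 λ ()) (apart signedD signed00 λ ()))

  last⇒middle : ∀ {r} → LastRow r → MiddleRow r
  last⇒middle = [ inj₁ , inj₂ ∘ [ inj₁ , inj₂ ∘ inj₁ ] ]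

  length-middle : ∀ r → MiddleRow r → length r ≡ n
  length-middle r (inj₁ (len , _)) = len
  length-middle r (inj₂ (inj₁ (w , (len , _) , _ , refl))) = cong (λ l → suc (suc l)) len
  length-middle r (inj₂ (inj₂ (inj₁ (w , (len , _) , _ , refl)))) =
    trans (length-zeros-suffix w 2) (cong (λ l → suc (suc l)) len)
  length-middle r (inj₂ (inj₂ (inj₂ (inj₁ (w , (len , _) , _ , refl))))) =
    cong (λ l → suc (suc l)) len
  length-middle r (inj₂ (inj₂ (inj₂ (inj₂ (w , (len , _) , refl))))) =
    cong suc (trans (length-zeros-suffix w 1) (cong suc len))

  open FramedVectors (λ (v : Vec Bool n) → toList v ≡ first) (λ v → toList v ≢ first)
                     (λ v → MiddleRow (toList v)) (λ v → LastRow (toList v))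

  countL : ∀ m′ → HasCard {suc (suc m′)} {n} InL
    (((Catalan (suc k) + ((Catalan k ∸ 1) + ((Catalan k ∸ 1) + ((Catalan k ∸ 1) + Catalan k)))) ∸ 1)
       ^ m′
      * ((Catalan (suc k) + ((Catalan k ∸ 1) + (Catalan k ∸ 1))) ∸ 1))
  countL =
    counted-Framed
      (counted-rows {n} (λ r → length-middle r ∘ proj₁)
                    (counted-remove _≟ʷ_ countMiddle first (inj₁ first∈D)))
      (counted-rows {n} (λ r → length-middle r ∘ last⇒middle ∘ proj₁)
                    (counted-remove _≟ʷ_ countLast first (inj₁ first∈D)))
      (counted-rows {n} (λ { r refl → proj₁ first∈D }) (counted-singleton first))

  countClosed : ∀ m′ → HasCard {suc (suc m′)} {n} InL
    (((Catalan (suc k) ∸ 1) + (4 * Catalan k ∸ 3)) ^ m′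
      * ((Catalan (suc k) ∸ 1) + (2 * Catalan k ∸ 2)))
  countClosed m′ = subst (HasCard InL) (cong₂ (λ a b → a ^ m′ * b) middle last) (countL m′)
    where
    X≥1 : 1 ≤ Catalan k
    X≥1 = counted-positive dyck-k u∈D
    Y≥1 : 1 ≤ Catalan (suc k)
    Y≥1 = counted-positive countD first∈D
    middle : (Catalan (suc k) + ((Catalan k ∸ 1) + ((Catalan k ∸ 1) + ((Catalan k ∸ 1) + Catalan k))))
               ∸ 1
             ≡ (Catalan (suc k) ∸ 1) + (4 * Catalan k ∸ 3)
    middle = trans (+-∸-comm _ Y≥1) (cong (Catalan (suc k) ∸ 1 +_) (four-shapes _ X≥1))
    last : (Catalan (suc k) + ((Catalan k ∸ 1) + (Catalan k ∸ 1))) ∸ 1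
           ≡ (Catalan (suc k) ∸ 1) + (2 * Catalan k ∸ 2)
    last = trans (+-∸-comm _ Y≥1) (cong (Catalan (suc k) ∸ 1 +_) (two-shapes _ X≥1))

-- The row shapes have
-- signatures  1w: (t+2, no),  w0: (t+1, no),  0w: (t+1, yes),  and no admissible
-- row is the first row 11u0, of signature (t+2, no): for 1w this is w ≠ 1u0.
module RowsB (t : ℕ) (u : List Bool) (u∈D : InD (t + t) u) where
  n : ℕ
  n = suc (suc (suc (t + t)))
  open PartB n u

  L≡2t+2 : suc (suc (t + t)) ≡ suc t + suc t
  L≡2t+2 = cong suc (sym (+-suc t t))

  forbidden∈D : InD (suc (suc (t + t))) forbidden
  forbidden∈D = dyck-wrap u∈D

  dyck-L : Counted (InD (suc (suc (t + t)))) (Catalan (suc t))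
  dyck-L = counted-Dyck (suc t) L≡2t+2

  count1w : Counted Form1w (Catalan (suc t) ∸ 1)
  count1w = counted-image-without _≟ʷ_ (true ∷_) ∷-injectiveʳ dyck-L forbidden forbidden∈D

  countw0 : Counted Formw0 (Catalan (suc t) ∸ 1)
  countw0 =
    counted-image-without _≟ʷ_ (_++ false ∷ []) (++-cancelʳ _ _ _) dyck-L forbidden forbidden∈D

  count0w : Counted Form0w (Catalan (suc t))
  count0w = counted-image (false ∷_) ∷-injectiveʳ dyck-L

  signed1w : Signed Form1w (suc (suc t) , false)
  signed1w (w , d , _ , refl) = cong (λ o → suc o , false) (dyck-ones d L≡2t+2)

  signedw0 : Signed Formw0 (suc t , false)
  signedw0 (w , d , _ , refl) = signature-dyck-zeros 1 d (dyck-ones d L≡2t+2)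

  signed0w : Signed Form0w (suc t , true)
  signed0w (w , d , refl) = cong (_, true) (dyck-ones d L≡2t+2)

  signedFirst : Signed (_≡ first) (suc (suc t) , false)
  signedFirst refl = cong (λ o → suc o , false) (dyck-ones forbidden∈D L≡2t+2)

  last⇒middle : ∀ {r} → LastRow r → MiddleRow r
  last⇒middle = [ inj₁ , inj₂ ∘ inj₁ ]

  middle≢first : ∀ r → MiddleRow r → r ≢ first
  middle≢first r (inj₁ (w , _ , w≢forbidden , refl)) r≡first =
    w≢forbidden (∷-injectiveʳ r≡first)
  middle≢first r (inj₂ (inj₁ p)) = apart signedw0 signedFirst (λ ()) r p
  middle≢first r (inj₂ (inj₂ p)) = apart signed0w signedFirst (λ ()) r p

  countMiddle : Counted (λ r → MiddleRow r × r ≢ first)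
    ((Catalan (suc t) ∸ 1) + ((Catalan (suc t) ∸ 1) + Catalan (suc t)))
  countMiddle = counted-avoid
    (counted-⊎ count1w (counted-⊎ countw0 count0w (apart signedw0 signed0w λ ()))
               (apart-⊎ (apart signed1w signedw0 λ ()) (apart signed1w signed0w λ ())))
    middle≢first

  countLast : Counted (λ r → LastRow r × r ≢ first)
    ((Catalan (suc t) ∸ 1) + (Catalan (suc t) ∸ 1))
  countLast = counted-avoid (counted-⊎ count1w countw0 (apart signed1w signedw0 λ ()))
                            (λ r → middle≢first r ∘ last⇒middle)

  length-middle : ∀ r → MiddleRow r → length r ≡ n
  length-middle r (inj₁ (w , (len , _) , _ , refl))        = cong suc len
  length-middle r (inj₂ (inj₁ (w , (len , _) , _ , refl))) =
    trans (length-zeros-suffix w 1) (cong suc len)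
  length-middle r (inj₂ (inj₂ (w , (len , _) , refl)))     = cong suc len

  open FramedVectors (λ (v : Vec Bool n) → toList v ≡ first) (λ v → toList v ≢ first)
                     (λ v → MiddleRow (toList v)) (λ v → LastRow (toList v))

  countL : ∀ m′ → HasCard {suc (suc m′)} {n} InL
    (((Catalan (suc t) ∸ 1) + ((Catalan (suc t) ∸ 1) + Catalan (suc t))) ^ m′
      * ((Catalan (suc t) ∸ 1) + (Catalan (suc t) ∸ 1)))
  countL =
    counted-Framed
      (counted-rows {n} (λ r → length-middle r ∘ proj₁) countMiddle)
      (counted-rows {n} (λ r → length-middle r ∘ last⇒middle ∘ proj₁) countLast)
      (counted-rows {n} (λ { r refl → cong suc (proj₁ forbidden∈D) }) (counted-singleton first))

  countClosed : ∀ m′ → HasCard {suc (suc m′)} {n} InL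
    ((3 * Catalan (suc t) ∸ 2) ^ m′ * (2 * Catalan (suc t) ∸ 2))
  countClosed m′ =
    subst (HasCard InL) (cong₂ (λ a b → a ^ m′ * b) (three-shapes _ X≥1) (two-shapes _ X≥1))
          (countL m′)
    where
    X≥1 : 1 ≤ Catalan (suc t)
    X≥1 = counted-positive dyck-L forbidden∈D

half-double : ∀ k → (k + k) / 2 ≡ k
half-double k = trans (cong (_/ 2) (double k)) (m*n/n≡m k 2)
  where
  double : ∀ k → k + k ≡ k * 2
  double = solve-∀

half-double+2 : ∀ k → suc (suc (k + k)) / 2 ≡ suc k
half-double+2 k = trans (cong (_/ 2) (cong suc (sym (+-suc k k)))) (half-double (suc k))

even-shape : ∀ n → 4 ≤ n → n % 2 ≡ 0 → ∃ λ j → n ≡ suc (suc (suc j + suc j))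
even-shape n 4≤n n%2≡0 = shape (n / 2) (subst (4 ≤_) n≡2q 4≤n) n≡2q
  where
  n≡2q : n ≡ n / 2 * 2
  n≡2q = trans (m≡m%n+[m/n]*n n 2) (cong (_+ n / 2 * 2) n%2≡0)
  double : ∀ j → suc (suc j) * 2 ≡ suc (suc (suc j + suc j))
  double = solve-∀
  shape : ∀ q → 4 ≤ q * 2 → n ≡ q * 2 → ∃ λ j → n ≡ suc (suc (suc j + suc j))
  shape 0             ()
  shape 1             (s≤s (s≤s ()))
  shape (suc (suc j)) _ n≡2q = j , trans n≡2q (double j)

odd-shape : ∀ n → 5 ≤ n → n % 2 ≡ 1 → ∃ λ t → n ≡ suc (suc (suc (t + t)))
odd-shape n 5≤n n%2≡1 = shape (n / 2) (subst (5 ≤_) n≡2q+1 5≤n) n≡2q+1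
  where
  n≡2q+1 : n ≡ 1 + n / 2 * 2
  n≡2q+1 = trans (m≡m%n+[m/n]*n n 2) (cong (_+ n / 2 * 2) n%2≡1)
  double+1 : ∀ t → 1 + suc t * 2 ≡ suc (suc (suc (t + t)))
  double+1 = solve-∀
  shape : ∀ q → 5 ≤ 1 + q * 2 → n ≡ 1 + q * 2 → ∃ λ t → n ≡ suc (suc (suc (t + t)))
  shape 0       (s≤s ())
  shape (suc t) _ n≡2q+1 = t , trans n≡2q+1 (double+1 t)

theoremA : ∀ (m n : ℕ) (u : List Bool) → 2 ≤ m → 4 ≤ n → n % 2 ≡ 0 → InD (n ∸ 2) u →
  HasCard (PartA.InL n u {m})
    (((Catalan (n / 2) ∸ 1) + (4 * Catalan ((n ∸ 2) / 2) ∸ 3)) ^ (m ∸ 2)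
      * ((Catalan (n / 2) ∸ 1) + (2 * Catalan ((n ∸ 2) / 2) ∸ 2)))
theoremA (suc (suc m′)) n u (s≤s (s≤s z≤n)) 4≤n n-even u∈D with even-shape n 4≤n n-even
... | j , refl rewrite half-double+2 (suc j) | half-double (suc j) =
  RowsA.countClosed j u u∈D m′

theoremB : ∀ (m n : ℕ) (u : List Bool) → 2 ≤ m → 5 ≤ n → n % 2 ≡ 1 → InD (n ∸ 3) u →
  HasCard (PartB.InL n u {m})
    ((3 * Catalan ((n ∸ 1) / 2) ∸ 2) ^ (m ∸ 2) * (2 * Catalan ((n ∸ 1) / 2) ∸ 2))
theoremB (suc (suc m′)) n u (s≤s (s≤s z≤n)) 5≤n n-odd u∈D with odd-shape n 5≤n n-odd
... | t , refl rewrite half-double+2 t = RowsB.countClosed t u u∈D m′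

mainTheorem3 : (∀ (m n : ℕ) (u : List Bool) → 2 ≤ m → 4 ≤ n → n % 2 ≡ 0 → InD (n ∸ 2) u →
    HasCard (PartA.InL n u {m})
    (((Catalan (n / 2) ∸ 1) + (4 * Catalan ((n ∸ 2) / 2) ∸ 3)) ^ (m ∸ 2)
    * ((Catalan (n / 2) ∸ 1) + (2 * Catalan ((n ∸ 2) / 2) ∸ 2))))
    ×
    (∀ (m n : ℕ) (u : List Bool) → 2 ≤ m → 5 ≤ n → n % 2 ≡ 1 → InD (n ∸ 3) u →
    HasCard (PartB.InL n u {m})
    ((3 * Catalan ((n ∸ 1) / 2) ∸ 2) ^ (m ∸ 2)
    * (2 * Catalan ((n ∸ 1) / 2) ∸ 2)))
mainTheorem3 = theoremA , theoremB
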